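{- (a) The longest square-free tournament words over $A_4=\{0,1,2,3\}$ have length $20$; they are exactly $w=01201320120320132032$ and the words obtained from $w$ by permuting the letters. (b) There exist infinite square-free tournament words over $A_5=\{0,1,2,3,4\}$.
   Context: A (finite or infinite) word $w$ over $A_n$ is a tournament word if for all distinct letters $i,j$, if $ij$ is a factor of $w$ then $ji$ is not a factor of $w$. A word is square-free if it has no factor $uu$ with $u$ nonempty. -}

module Defs where

open import Data.Nat using (ℕ; zero; suc; _+_; _≤_)
open import Data.Fin using (Fin; zero; suc)
open import Data.List using (List; []; _∷_; _++_; length; map)
open import Data.Product using (Σ; ∃; ∃-syntax; _×_; _,_)
open import Relation.Binary.PropositionalEquality using (_≡_; _≢_)
open import Relation.Nullary using (¬_)
open import Data.Fin.Permutation using (Permutation′; _⟨$⟩ʳ_)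

Word : ℕ → Set
Word n = List (Fin n)

InfWord : ℕ → Set
InfWord n = ℕ → Fin n

Factor : ∀ {n} → Word n → Word n → Set
Factor x w = ∃[ u ] ∃[ v ] (w ≡ u ++ x ++ v)

window : ∀ {n} → InfWord n → ℕ → ℕ → Word n
window w k zero = []
window w k (suc m) = w k ∷ window w (suc k) m

InfFactor : ∀ {n} → Word n → InfWord n → Set
InfFactor x w = ∃[ k ] (x ≡ window w k (length x))

SquareFreeWrt : ∀ {n} → (Word n → Set) → Set
SquareFreeWrt {n} F = (u : Word n) → u ≢ [] → ¬ F (u ++ u)

TournamentWrt : ∀ {n} → (Word n → Set) → Set
TournamentWrt {n} F = (i j : Fin n) → i ≢ j →
  F (i ∷ j ∷ []) → ¬ F (j ∷ i ∷ [])

SquareFree : ∀ {n} → Word n → Set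
SquareFree w = SquareFreeWrt (λ x → Factor x w)

Tournament : ∀ {n} → Word n → Set
Tournament w = TournamentWrt (λ x → Factor x w)

InfSquareFree : ∀ {n} → InfWord n → Set
InfSquareFree w = SquareFreeWrt (λ x → InfFactor x w)

InfTournament : ∀ {n} → InfWord n → Set
InfTournament w = TournamentWrt (λ x → InfFactor x w)

SFT : ∀ {n} → Word n → Set
SFT w = SquareFree w × Tournament w

private
  a b c d : Fin 4
  a = zero
  b = suc zero
  c = suc (suc zero)
  d = suc (suc (suc zero))

w₀ : Word 4
w₀ = a ∷ b ∷ c ∷ a ∷ b ∷ d ∷ c ∷ a ∷ b ∷ c ∷
     a ∷ d ∷ c ∷ a ∷ b ∷ d ∷ c ∷ a ∷ d ∷ c ∷ []

-- (a) A word a ∷ w is a square-free tournament word iff w is one and the new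
-- factors of a ∷ w, namely its prefixes, create neither a square nor a pair
-- whose reversal occurs in w.  So the square-free tournament words of each
-- length are obtained by extending those of the previous length by one letter
-- on the left.  Over four letters this enumeration dies out at length 21, and
-- at length 20 it consists of renamings of w₀; renaming letters injectively
-- preserves both properties.
--
-- (b) Let hω be the fixed point of the 6-uniform morphism h below.  The set of
-- its factors of length 22 is finite, computable and closed under passing from
-- the factor at position s / 6 to the one at s; checking this set excludes
-- squares of period at most 11 and reversed pairs.  In a square of period
-- p ≥ 12, if 6 ∤ p then some image h a occurs in some h c ++ h d at an offset
-- 1, …, 5, which never happens.  If p = 6 m, comparing the blocks h (hω k) of
-- the two halves (h is injective, and a suffix/prefix test decides the two
-- partial blocks) yields a square of period m in hω, and we conclude by
-- induction on the period.
module Submission where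

open import Defs
open import Data.Bool using (true)
open import Data.Empty using (⊥-elim)
open import Data.Unit using (⊤; tt)
open import Data.Nat
  using (ℕ; zero; suc; _+_; _*_; _∸_; _≤_; _<_; s≤s; z≤n; _/_; _%_; _<?_; allUpTo?)
open import Data.Nat.Properties
  using ( +-identityʳ; +-suc; +-assoc; +-comm; *-comm; *-suc; *-distribˡ-+
        ; ≤-reflexive; ≤-trans; ≤-pred; n≤1+n; m≤m+n; <⇒≤; ≮⇒≥; m∸n≤m
        ; m+[n∸m]≡n; m∸[m∸n]≡n; m≤n⇒∃[o]m+o≡n; m≤n⇒m<n∨m≡n
        ; +-monoˡ-≤; +-mono-≤; *-monoʳ-≤; module ≤-Reasoning )
open import Data.Nat.DivMod
  using (m≡m%n+[m/n]*n; m%n<n; m/n<m; [m+kn]%n≡m%n; m*n%n≡0; m<n⇒m%n≡m; m<n⇒m/n≡0; m*n/n≡m; +-distrib-/; /-monoˡ-≤)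
open import Data.Nat.Induction using (<-rec)
open import Data.Nat.Tactic.RingSolver using (solve-∀)
open import Data.Fin using (Fin; zero; _≟_)
open import Data.Fin.Patterns using (0F; 1F; 2F; 3F; 4F)
import Data.Fin.Properties as Fin
open import Data.Fin.Permutation using (Permutation′; _⟨$⟩ʳ_; id; insert)
open import Data.List
  using (List; []; _∷_; _++_; length; map; take; drop; filter; concatMap; allFin; upTo; deduplicate; reverse)
open import Data.List.Properties using (≡-dec; ++-assoc; length-++; length-drop; map-injective; ∷-injectiveˡ; ∷-injectiveʳ)
open import Data.List.Relation.Unary.All as All using (All; all?)
import Data.List.Relation.Unary.All.Properties as All
open import Data.List.Relation.Unary.Any as Any using (Any; here; there; any?)
open import Data.List.Relation.Unary.Any.Properties using (¬Any[])
open import Data.List.Membership.Propositional using (_∈_)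
open import Data.List.Membership.Propositional.Properties using (∈-map⁺; ∈-filter⁺; ∈-concatMap⁺; ∈-allFin)
open import Data.List.Relation.Binary.Pointwise using (Pointwise-≡⇒≡; ≡⇒Pointwise-≡)
open import Data.List.Relation.Binary.Prefix.Heterogeneous as Prefix using (Prefix)
open import Data.List.Relation.Binary.Prefix.Heterogeneous.Properties using (prefix?)
open import Data.List.Relation.Binary.Infix.Heterogeneous as Infix using (Infix; MkView)
open import Data.List.Relation.Binary.Infix.Heterogeneous.Properties using (infix?)
open import Data.Product using (∃-syntax; _×_; _,_; proj₁; proj₂)
open import Data.Sum using (_⊎_; inj₁; inj₂; [_,_]′)
import Data.Sum as Sum
open import Function using (_∘_)
open import Function.Bundles using (Injection)
open import Function.Definitions using (Injective)
open import Function.Properties.Inverse using (↔⇒↣)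
open import Relation.Binary.PropositionalEquality
  using (_≡_; _≢_; refl; sym; trans; cong; cong₂; subst; subst₂; module ≡-Reasoning)
open import Relation.Nullary using (¬_; Dec; yes; no; does)
open import Relation.Nullary.Decidable using (map′; ¬?; _×-dec_; _→-dec_; _⊎-dec_)

-- Used instead of toWitness: checking `refl : does a? ≡ true` evaluates the
-- decision procedure far faster than checking `tt : True a?`.
from-does : ∀ {A : Set} (a? : Dec A) → does a? ≡ true → A
from-does (yes a) _ = a

take-length-++ : ∀ {A : Set} (u v : List A) → take (length u) (u ++ v) ≡ u
take-length-++ []      v = refl
take-length-++ (a ∷ u) v = cong (a ∷_) (take-length-++ u v)

drop-length-++ : ∀ {A : Set} (u v : List A) → drop (length u) (u ++ v) ≡ v
drop-length-++ []      v = refl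
drop-length-++ (a ∷ u) v = drop-length-++ u v

_∈?_ : ∀ {n} (v : Word n) (S : List (Word n)) → Dec (v ∈ S)
v ∈? S = any? (≡-dec _≟_ v) S

-- Factors of finite words

module _ {n : ℕ} where

  Factor⇒Infix : ∀ {x w : Word n} → Factor x w → Infix _≡_ x w
  Factor⇒Infix (u , v , refl) = Infix.fromView (MkView u (≡⇒Pointwise-≡ refl) v)

  Infix⇒Factor : ∀ {x w : Word n} → Infix _≡_ x w → Factor x w
  Infix⇒Factor p with Infix.toView p
  ... | MkView u x≋y v rewrite Pointwise-≡⇒≡ x≋y = u , v , refl

  factor? : (x w : Word n) → Dec (Factor x w)
  factor? x w = map′ Infix⇒Factor Factor⇒Infix (infix? _≟_ x w)

  IsPrefix : Word n → Word n → Set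
  IsPrefix x z = ∃[ v ] z ≡ x ++ v

  isPrefix? : (x z : Word n) → Dec (IsPrefix x z)
  isPrefix? x z = map′ to from (prefix? _≟_ x z)
    where
    to : ∀ {x z} → Prefix _≡_ x z → IsPrefix x z
    to p with Prefix.toView p
    ... | x≋y Prefix.++ v rewrite Pointwise-≡⇒≡ x≋y = v , refl
    from : ∀ {x z} → IsPrefix x z → Prefix _≡_ x z
    from (v , refl) = Prefix.fromView (≡⇒Pointwise-≡ refl Prefix.++ v)

  Factor-∷⁺ : ∀ {x w : Word n} a → Factor x w → Factor x (a ∷ w)
  Factor-∷⁺ a (u , v , eq) = a ∷ u , v , cong (a ∷_) eq

  Factor-∷⁻ : ∀ {x w : Word n} {a} → Factor x (a ∷ w) → IsPrefix x (a ∷ w) ⊎ Factor x w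
  Factor-∷⁻ ([]    , v , eq)   = inj₁ (v , eq)
  Factor-∷⁻ (_ ∷ u , v , refl) = inj₂ (u , v , refl)

  nonemptyPrefixes : Word n → List (Word n)
  nonemptyPrefixes []      = []
  nonemptyPrefixes (a ∷ z) = (a ∷ []) ∷ map (a ∷_) (nonemptyPrefixes z)

  ∈-nonemptyPrefixes : ∀ {u} z → u ≢ [] → IsPrefix u z → u ∈ nonemptyPrefixes z
  ∈-nonemptyPrefixes {[]}        z       u≢[] _          = ⊥-elim (u≢[] refl)
  ∈-nonemptyPrefixes {a ∷ []}    (a ∷ z) _    (v , refl) = here refl
  ∈-nonemptyPrefixes {a ∷ b ∷ u} (a ∷ z) _    (v , refl) =
    there (∈-map⁺ (a ∷_) (∈-nonemptyPrefixes z (λ ()) (v , refl)))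

  nonemptyPrefixes-≢[] : ∀ z → All (_≢ []) (nonemptyPrefixes z)
  nonemptyPrefixes-≢[] []      = All.[]
  nonemptyPrefixes-≢[] (a ∷ z) = (λ ()) All.∷ All.map⁺ (All.map (λ _ ()) (nonemptyPrefixes-≢[] z))

  SquarePrefixFree : Word n → Set
  SquarePrefixFree z = ∀ u → u ≢ [] → ¬ IsPrefix (u ++ u) z

  squarePrefixFree? : (z : Word n) → Dec (SquarePrefixFree z)
  squarePrefixFree? z = map′ sound complete (all? (λ u → ¬? (isPrefix? (u ++ u) z)) (nonemptyPrefixes z))
    where
    sound : All (λ u → ¬ IsPrefix (u ++ u) z) (nonemptyPrefixes z) → SquarePrefixFree z
    sound none u u≢[] (v , refl) = All.lookup none (∈-nonemptyPrefixes z u≢[] (u ++ v , ++-assoc u u v)) (v , refl)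
    complete : SquarePrefixFree z → All (λ u → ¬ IsPrefix (u ++ u) z) (nonemptyPrefixes z)
    complete spf = All.map (λ {u} u≢[] → spf u u≢[]) (nonemptyPrefixes-≢[] z)

  ReversalAbsent : Fin n → Word n → Set
  ReversalAbsent a []      = ⊤
  ReversalAbsent a (b ∷ w) = a ≢ b → ¬ Factor (b ∷ a ∷ []) (b ∷ w)

  reversalAbsent? : ∀ a w → Dec (ReversalAbsent a w)
  reversalAbsent? a []      = yes tt
  reversalAbsent? a (b ∷ w) = ¬? (a ≟ b) →-dec ¬? (factor? (b ∷ a ∷ []) (b ∷ w))

  Prependable : Fin n → Word n → Set
  Prependable a w = SquarePrefixFree (a ∷ w) × ReversalAbsent a w

  prependable? : ∀ a w → Dec (Prependable a w)
  prependable? a w = squarePrefixFree? (a ∷ w) ×-dec reversalAbsent? a w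

  SFT-[] : SFT {n} []
  SFT-[] = (λ { [] u≢[] _ → u≢[] refl ; (_ ∷ _) _ ([] , _ , ()) ; (_ ∷ _) _ (_ ∷ _ , _ , ()) })
         , (λ { _ _ _ ([] , _ , ()) ; _ _ _ (_ ∷ _ , _ , ()) })

  SFT-∷⁺ : ∀ {a w} → SFT w → Prependable a w → SFT (a ∷ w)
  SFT-∷⁺ {a} {w} (sf , tr) (spf , ra) = squareFree , tournament
    where
    squareFree : SquareFree (a ∷ w)
    squareFree u u≢[] f with Factor-∷⁻ f
    ... | inj₁ p  = spf u u≢[] p
    ... | inj₂ f′ = sf u u≢[] f′
    tournament : Tournament (a ∷ w)
    tournament i j i≢j f g with Factor-∷⁻ f | Factor-∷⁻ g
    ... | inj₂ f′         | inj₂ g′         = tr i j i≢j f′ g′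
    ... | inj₁ (_ , refl) | inj₁ (_ , refl) = i≢j refl
    ... | inj₁ (_ , refl) | inj₂ g′         = ra i≢j g′
    ... | inj₂ f′         | inj₁ (_ , refl) = ra (i≢j ∘ sym) f′

  SFT⇒ReversalAbsent : ∀ {a} w → SFT (a ∷ w) → ReversalAbsent a w
  SFT⇒ReversalAbsent []      _        = tt
  SFT⇒ReversalAbsent (b ∷ w) (_ , tr) a≢b f = tr _ b a≢b ([] , w , refl) (Factor-∷⁺ _ f)

  SFT-∷⁻ : ∀ {a w} → SFT (a ∷ w) → SFT w × Prependable a w
  SFT-∷⁻ {a} {w} s@(sf , tr) = (squareFree , tournament) , (λ u u≢[] p → sf u u≢[] ([] , p)) , SFT⇒ReversalAbsent w s
    where
    squareFree : SquareFree w
    squareFree u u≢[] f = sf u u≢[] (Factor-∷⁺ a f)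
    tournament : Tournament w
    tournament i j i≢j f g = tr i j i≢j (Factor-∷⁺ a f) (Factor-∷⁺ a g)

  SFT? : (w : Word n) → Dec (SFT w)
  SFT? []      = yes SFT-[]
  SFT? (a ∷ w) = map′ (λ (s , p) → SFT-∷⁺ s p) SFT-∷⁻ (SFT? w ×-dec prependable? a w)

module Enumeration {n : ℕ} {P : Word n → Set} {E : Fin n → Word n → Set}
                   (E? : ∀ a w → Dec (E a w)) (P-∷⁻ : ∀ {a w} → P (a ∷ w) → P w × E a w) where

  extensions : Word n → List (Word n)
  extensions w = map (_∷ w) (filter (λ a → E? a w) (allFin n))

  wordsOfLength : ℕ → List (Word n)
  wordsOfLength zero    = [] ∷ []
  wordsOfLength (suc k) = concatMap extensions (wordsOfLength k)

  ∈-wordsOfLength : ∀ {w} → P w → w ∈ wordsOfLength (length w)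
  ∈-wordsOfLength {[]}    _  = here refl
  ∈-wordsOfLength {a ∷ w} pw = ∈-concatMap⁺ extensions (Any.map (λ { refl → a∷w∈ }) (∈-wordsOfLength (proj₁ (P-∷⁻ pw))))
    where
    a∷w∈ : a ∷ w ∈ extensions w
    a∷w∈ = ∈-map⁺ (_∷ w) (∈-filter⁺ (λ a → E? a w) (∈-allFin a) (proj₂ (P-∷⁻ pw)))

  P-drop : ∀ k {w} → P w → P (drop k w)
  P-drop zero            pw = pw
  P-drop (suc k) {[]}    pw = pw
  P-drop (suc k) {a ∷ w} pw = P-drop k (proj₁ (P-∷⁻ pw))

  length< : ∀ {k w} → wordsOfLength k ≡ [] → P w → length w < k
  length< {k} {w} none pw with length w <? k
  ... | yes |w|<k = |w|<k
  ... | no  |w|≮k = ⊥-elim (¬Any[] (subst (drop d w ∈_) (trans (cong wordsOfLength |drop|≡k) none)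
                                             (∈-wordsOfLength (P-drop d pw))))
    where
    d = length w ∸ k
    |drop|≡k : length (drop d w) ≡ k
    |drop|≡k = trans (length-drop d w) (m∸[m∸n]≡n (≮⇒≥ |w|≮k))

module _ {m n : ℕ} {f : Fin m → Fin n} where

  map-≡-++⁻ : ∀ (w : Word m) a {b} → map f w ≡ a ++ b →
              ∃[ a′ ] ∃[ b′ ] (w ≡ a′ ++ b′ × map f a′ ≡ a × map f b′ ≡ b)
  map-≡-++⁻ w       []      eq = [] , w , refl , refl , eq
  map-≡-++⁻ (c ∷ w) (_ ∷ a) eq with map-≡-++⁻ w a (∷-injectiveʳ eq)
  ... | a′ , b′ , refl , refl , refl = c ∷ a′ , b′ , refl , cong (_∷ _) (∷-injectiveˡ eq) , refl

  Factor-map⁻ : ∀ {x} (w : Word m) → Factor x (map f w) → ∃[ x′ ] (Factor x′ w × map f x′ ≡ x)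
  Factor-map⁻ {x} w (u , v , eq) with map-≡-++⁻ w u eq
  ... | u′ , r , refl , _ , eq′ with map-≡-++⁻ r x eq′
  ... | x′ , v′ , refl , fx′ , _ = x′ , (u′ , v′ , refl) , fx′

  SFT-map : Injective _≡_ _≡_ f → ∀ {w} → SFT w → SFT (map f w)
  SFT-map f-inj {w} (sf , tr) = squareFree , tournament
    where
    squareFree : SquareFree (map f w)
    squareFree u u≢[] fac with Factor-map⁻ w fac
    ... | x′ , fac′ , fx′ with map-≡-++⁻ x′ u fx′
    ... | u₁ , u₂ , refl , fu₁ , fu₂ with map-injective f-inj (trans fu₁ (sym fu₂))
    ... | refl = sf u₁ (λ { refl → u≢[] (sym fu₁) }) fac′
    tournament : Tournament (map f w)
    tournament i j i≢j fac₁ fac₂ with Factor-map⁻ w fac₁ | Factor-map⁻ w fac₂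
    ... | i′ ∷ j′ ∷ [] , fac₁′ , refl | y′ , fac₂′ , fy′ with map-injective f-inj fy′
    ... | refl = tr i′ j′ (λ { refl → i≢j refl }) fac₁′ fac₂′
    tournament i j i≢j fac₁ fac₂ | []            , _ , () | _
    tournament i j i≢j fac₁ fac₂ | _ ∷ []        , _ , () | _
    tournament i j i≢j fac₁ fac₂ | _ ∷ _ ∷ _ ∷ _ , _ , () | _

permutations : ∀ n → List (Permutation′ n)
permutations zero    = id ∷ []
permutations (suc n) = concatMap (λ i → map (insert zero i) (permutations n)) (allFin (suc n))

IsRenamingOf : ∀ {n} → Word n → Word n → Set
IsRenamingOf w′ w = Any (λ π → w ≡ map (π ⟨$⟩ʳ_) w′) (permutations _)

isRenamingOf? : ∀ {n} (w′ w : Word n) → Dec (IsRenamingOf w′ w)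
isRenamingOf? w′ w = any? (λ π → ≡-dec _≟_ w (map (π ⟨$⟩ʳ_) w′)) (permutations _)

rename-injective : ∀ {n} (π : Permutation′ n) → Injective _≡_ _≡_ (π ⟨$⟩ʳ_)
rename-injective π = Injection.injective (↔⇒↣ π)

-- Square-free tournament words over four letters

open Enumeration (prependable? {4}) SFT-∷⁻ using (wordsOfLength; ∈-wordsOfLength; length<)

SFT-w₀ : SFT w₀
SFT-w₀ = from-does (SFT? w₀) refl

SFT-length≤20 : (w : Word 4) → SFT w → length w ≤ 20
SFT-length≤20 w s = ≤-pred (length< refl s)

wordsOfLength20-renamings : All (IsRenamingOf w₀) (wordsOfLength 20)
wordsOfLength20-renamings = from-does (all? (isRenamingOf? w₀) (wordsOfLength 20)) refl

SFT-length20-renaming : (w : Word 4) → SFT w → length w ≡ 20 → ∃[ π ] (w ≡ map (π ⟨$⟩ʳ_) w₀)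
SFT-length20-renaming w s |w|≡20 =
  Any.satisfied (All.lookup wordsOfLength20-renamings (subst (λ k → w ∈ wordsOfLength k) |w|≡20 (∈-wordsOfLength s)))

module _ {n : ℕ} where

  window-cong : ∀ {x y : InfWord n} a b L → (∀ t → t < L → x (a + t) ≡ y (b + t)) →
                window x a L ≡ window y b L
  window-cong     a b zero    _  = refl
  window-cong {x} {y} a b (suc L) eq = cong₂ _∷_ head≡ (window-cong (suc a) (suc b) L tail≡)
    where
    head≡ : x a ≡ y b
    head≡ = subst₂ (λ i j → x i ≡ y j) (+-identityʳ a) (+-identityʳ b) (eq 0 (s≤s z≤n))
    tail≡ : ∀ t → t < L → x (suc a + t) ≡ y (suc b + t)
    tail≡ t t<L rewrite sym (+-suc a t) | sym (+-suc b t) = eq (suc t) (s≤s t<L)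

module _ {n : ℕ} (x : InfWord n) where

  window-++ : ∀ a m k → window x a (m + k) ≡ window x a m ++ window x (a + m) k
  window-++ a zero    k rewrite +-identityʳ a = refl
  window-++ a (suc m) k rewrite window-++ (suc a) m k | +-suc a m = refl

  take-window : ∀ a {m N} → m ≤ N → take m (window x a N) ≡ window x a m
  take-window a {zero}  _         = refl
  take-window a {suc m} (s≤s m≤N) = cong (x a ∷_) (take-window (suc a) m≤N)

  drop-window : ∀ a m k → drop m (window x a (m + k)) ≡ window x (a + m) k
  drop-window a zero    k rewrite +-identityʳ a = refl
  drop-window a (suc m) k rewrite drop-window (suc a) m k | +-suc a m = refl

  take-drop-window : ∀ a {t L N} → t + L ≤ N → take L (drop t (window x a N)) ≡ window x (a + t) L
  take-drop-window a {t} {L} t+L≤N with k , refl ← m≤n⇒∃[o]m+o≡n t+L≤N = begin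
    take L (drop t (window x a (t + L + k)))   ≡⟨ cong (take L ∘ drop t ∘ window x a) (+-assoc t L k) ⟩
    take L (drop t (window x a (t + (L + k)))) ≡⟨ cong (take L) (drop-window a t (L + k)) ⟩
    take L (window x (a + t) (L + k))          ≡⟨ take-window (a + t) (m≤m+n L k) ⟩
    window x (a + t) L                         ∎
    where open ≡-Reasoning

  Square : ℕ → ℕ → Set
  Square s p = window x s p ≡ window x (s + p) p

  Square-window : ∀ {s p t L} → Square s p → t + L ≤ p → window x (s + t) L ≡ window x (s + t + p) L
  Square-window {s} {p} {t} {L} sq t+L≤p = begin
    window x (s + t) L                     ≡⟨ take-drop-window s t+L≤p ⟨
    take L (drop t (window x s p))         ≡⟨ cong (take L ∘ drop t) sq ⟩
    take L (drop t (window x (s + p) p))   ≡⟨ take-drop-window (s + p) t+L≤p ⟩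
    window x (s + p + t) L                 ≡⟨ cong (λ k → window x k L) (swap s p t) ⟩
    window x (s + t + p) L                 ∎
    where
    open ≡-Reasoning
    swap : ∀ a b c → a + b + c ≡ a + c + b
    swap = solve-∀

  InfFactor-square : ∀ u → InfFactor (u ++ u) x → ∃[ s ] Square s (length u)
  InfFactor-square u (s , uu≡) = s , trans (sym first-half) second-half
    where
    p = length u
    uu≡′ : u ++ u ≡ window x s (p + p)
    uu≡′ = trans uu≡ (cong (window x s) (length-++ u))
    first-half : u ≡ window x s p
    first-half = trans (sym (take-length-++ u u)) (trans (cong (take p) uu≡′) (take-window s (m≤m+n p p)))
    second-half : u ≡ window x (s + p) p
    second-half = trans (sym (drop-length-++ u u)) (trans (cong (drop p) uu≡′) (drop-window s p p))

-- The fixed point of h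

h : Fin 5 → Word 5
h 0F = 0F ∷ 2F ∷ 1F ∷ 4F ∷ 0F ∷ 2F ∷ []
h 1F = 0F ∷ 2F ∷ 4F ∷ 0F ∷ 2F ∷ 3F ∷ []
h 2F = 3F ∷ 1F ∷ 0F ∷ 2F ∷ 4F ∷ 3F ∷ []
h 3F = 0F ∷ 2F ∷ 3F ∷ 1F ∷ 4F ∷ 3F ∷ []
h 4F = 1F ∷ 4F ∷ 0F ∷ 2F ∷ 4F ∷ 3F ∷ []

-- Indexing with a junk value 0F past the end; only indices < 6 = length (h a) occur.
_!_ : Word 5 → ℕ → Fin 5
[]      ! _     = 0F
(a ∷ w) ! zero  = a
(a ∷ w) ! suc i = w ! i

-- Letter n of hω is letter n % 6 of h (letter n / 6 of hω); the fuel makes the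
-- recursion structural, and any fuel f ≥ n gives the right letter.
hω-fuel : ℕ → ℕ → Fin 5
hω-fuel zero    n = 0F
hω-fuel (suc f) n = h (hω-fuel f (n / 6)) ! (n % 6)

hω : InfWord 5
hω n = hω-fuel (suc n) n

hω-fuel-0 : ∀ f → hω-fuel f 0 ≡ 0F
hω-fuel-0 zero    = refl
hω-fuel-0 (suc f) rewrite hω-fuel-0 f = refl

n≤1+f⇒n/6≤f : ∀ {n f} → n ≤ suc f → n / 6 ≤ f
n≤1+f⇒n/6≤f {zero}  _      = z≤n
n≤1+f⇒n/6≤f {suc n} n≤1+f = ≤-pred (≤-trans (m/n<m (suc n) 6 (s≤s (s≤s z≤n))) n≤1+f)

hω-fuel-stable : ∀ f g {n} → n ≤ f → n ≤ g → hω-fuel f n ≡ hω-fuel g n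
hω-fuel-stable zero    g       z≤n _   = sym (hω-fuel-0 g)
hω-fuel-stable (suc f) zero    _   z≤n = hω-fuel-0 (suc f)
hω-fuel-stable (suc f) (suc g) {n} n≤f n≤g =
  cong (λ a → h a ! (n % 6)) (hω-fuel-stable f g (n≤1+f⇒n/6≤f n≤f) (n≤1+f⇒n/6≤f n≤g))

[6q+r]/6≡q : ∀ q {r} → r < 6 → (6 * q + r) / 6 ≡ q
[6q+r]/6≡q q {r} r<6 = begin
  (6 * q + r) / 6       ≡⟨ cong (_/ 6) (trans (+-comm (6 * q) r) (cong (r +_) (*-comm 6 q))) ⟩
  (r + q * 6) / 6       ≡⟨ +-distrib-/ r (q * 6) no-carry ⟩
  r / 6 + q * 6 / 6     ≡⟨ cong₂ _+_ (m<n⇒m/n≡0 r<6) (m*n/n≡m q 6) ⟩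
  q                     ∎
  where
  open ≡-Reasoning
  no-carry : r % 6 + q * 6 % 6 < 6
  no-carry = ≤-Reasoning.begin-strict
    r % 6 + q * 6 % 6   ≤-Reasoning.≡⟨ cong₂ _+_ (m<n⇒m%n≡m r<6) (m*n%n≡0 q 6) ⟩
    r + 0               ≤-Reasoning.≡⟨ +-identityʳ r ⟩
    r                   ≤-Reasoning.<⟨ r<6 ⟩
    6                   ≤-Reasoning.∎

[6q+r]%6≡r : ∀ q {r} → r < 6 → (6 * q + r) % 6 ≡ r
[6q+r]%6≡r q {r} r<6 = begin
  (6 * q + r) % 6       ≡⟨ cong (_% 6) (trans (+-comm (6 * q) r) (cong (r +_) (*-comm 6 q))) ⟩
  (r + q * 6) % 6       ≡⟨ [m+kn]%n≡m%n r q 6 ⟩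
  r % 6                 ≡⟨ m<n⇒m%n≡m r<6 ⟩
  r                     ∎
  where open ≡-Reasoning

hω-letter : ∀ q {r} → r < 6 → hω (6 * q + r) ≡ h (hω q) ! r
hω-letter q {r} r<6 rewrite [6q+r]/6≡q q r<6 | [6q+r]%6≡r q r<6 =
  cong (λ a → h a ! r) (hω-fuel-stable (6 * q + r) (suc q) (≤-trans (m≤m+n q (5 * q)) (m≤m+n (6 * q) r)) (n≤1+n q))

h-letters : ∀ a → window (h a !_) 0 6 ≡ h a
h-letters 0F = refl
h-letters 1F = refl
h-letters 2F = refl
h-letters 3F = refl
h-letters 4F = refl

hω-block : ∀ q → window hω (6 * q) 6 ≡ h (hω q)
hω-block q = trans (window-cong {x = hω} {y = h (hω q) !_} (6 * q) 0 6 (λ t t<6 → hω-letter q t<6)) (h-letters (hω q))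

hω-blocks : ∀ q M → window hω (6 * q) (6 * M) ≡ concatMap h (window hω q M)
hω-blocks q zero    = refl
hω-blocks q (suc M) = begin
  window hω (6 * q) (6 * suc M)                          ≡⟨ cong (window hω (6 * q)) (*-suc 6 M) ⟩
  window hω (6 * q) (6 + 6 * M)                          ≡⟨ window-++ hω (6 * q) 6 (6 * M) ⟩
  window hω (6 * q) 6 ++ window hω (6 * q + 6) (6 * M)   ≡⟨ cong₂ _++_ (hω-block q) (cong (λ k → window hω k (6 * M)) 6q+6≡6[1+q]) ⟩
  h (hω q) ++ window hω (6 * suc q) (6 * M)              ≡⟨ cong (h (hω q) ++_) (hω-blocks (suc q) M) ⟩
  h (hω q) ++ concatMap h (window hω (suc q) M)          ∎
  where
  open ≡-Reasoning
  6q+6≡6[1+q] : 6 * q + 6 ≡ 6 * suc q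
  6q+6≡6[1+q] = trans (+-comm (6 * q) 6) (sym (*-suc 6 q))

take-block : ∀ k {L} → L ≤ 6 → take L (h (hω k)) ≡ window hω (6 * k) L
take-block k L≤6 = trans (cong (take _) (sym (hω-block k))) (take-window hω (6 * k) L≤6)

drop-block : ∀ k {r g} → r + g ≡ 6 → drop r (h (hω k)) ≡ window hω (6 * k + r) g
drop-block k {r} {g} r+g≡6 = begin
  drop r (h (hω k))                     ≡⟨ cong (drop r) (hω-block k) ⟨
  drop r (window hω (6 * k) 6)          ≡⟨ cong (drop r ∘ window hω (6 * k)) r+g≡6 ⟨
  drop r (window hω (6 * k) (r + g))    ≡⟨ drop-window hω (6 * k) r g ⟩
  window hω (6 * k + r) g               ∎
  where open ≡-Reasoning

-- Position s lies in block q at offset r; the next block starts g letters later.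
module Position (s : ℕ) where
  q r g : ℕ
  q = s / 6
  r = s % 6
  g = 6 ∸ r

  r<6 : r < 6
  r<6 = m%n<n s 6

  r+g≡6 : r + g ≡ 6
  r+g≡6 = m+[n∸m]≡n (<⇒≤ r<6)

  g≤6 : g ≤ 6
  g≤6 = m∸n≤m 6 r

  s≡6q+r : s ≡ 6 * q + r
  s≡6q+r = trans (m≡m%n+[m/n]*n s 6) (trans (+-comm r (q * 6)) (cong (_+ r) (*-comm q 6)))

  s+g≡6[1+q] : s + g ≡ 6 * suc q
  s+g≡6[1+q] = begin
    s + g             ≡⟨ cong (_+ g) s≡6q+r ⟩
    6 * q + r + g     ≡⟨ +-assoc (6 * q) r g ⟩
    6 * q + (r + g)   ≡⟨ cong (6 * q +_) r+g≡6 ⟩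
    6 * q + 6         ≡⟨ +-comm (6 * q) 6 ⟩
    6 + 6 * q         ≡⟨ *-suc 6 q ⟨
    6 * suc q         ∎
    where open ≡-Reasoning

-- Factors of length 22 of hω

-- 350 is large enough for every factor of length 22 of hω to occur before it,
-- but the proof only uses (and checks) that this list is closed under h.
factors22 : List (Word 5)
factors22 = deduplicate (≡-dec _≟_) (map (λ s → window hω s 22) (upTo 350))

ClosedUnderH : List (Word 5) → Set
ClosedUnderH S = All (λ v → ∀ {r} → r < 6 → take 22 (drop r (concatMap h (take 5 v))) ∈ S) S

closedUnderH? : ∀ S → Dec (ClosedUnderH S)
closedUnderH? S = all? (λ v → allUpTo? (λ r → take 22 (drop r (concatMap h (take 5 v))) ∈? S) 6) S

factors22-closed : ClosedUnderH factors22
factors22-closed = from-does (closedUnderH? factors22) refl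

window-from-parent : ∀ q {r} → r < 6 →
                     window hω (6 * q + r) 22 ≡ take 22 (drop r (concatMap h (take 5 (window hω q 22))))
window-from-parent q {r} r<6 = begin
  window hω (6 * q + r) 22                              ≡⟨ take-drop-window hω (6 * q) r+22≤30 ⟨
  take 22 (drop r (window hω (6 * q) 30))               ≡⟨ cong (take 22 ∘ drop r) (hω-blocks q 5) ⟩
  take 22 (drop r (concatMap h (window hω q 5)))        ≡⟨ cong (take 22 ∘ drop r ∘ concatMap h) (take-window hω q {N = 22} (m≤m+n 5 17)) ⟨
  take 22 (drop r (concatMap h (take 5 (window hω q 22)))) ∎
  where
  open ≡-Reasoning
  r+22≤30 : r + 22 ≤ 30
  r+22≤30 = +-monoˡ-≤ 22 (≤-trans (≤-pred r<6) (m≤m+n 5 3))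

window∈factors22 : ∀ s → window hω s 22 ∈ factors22
window∈factors22 = <-rec _ step
  where
  step : ∀ s → (∀ {t} → t < s → window hω t 22 ∈ factors22) → window hω s 22 ∈ factors22
  step zero      _  = here refl
  step s@(suc _) ih = subst (_∈ factors22) (sym window≡) (All.lookup factors22-closed (ih q<s) r<6)
    where
    open Position s
    q<s : q < s
    q<s = m/n<m s 6 (s≤s (s≤s z≤n))
    window≡ : window hω s 22 ≡ take 22 (drop r (concatMap h (take 5 (window hω q 22))))
    window≡ = trans (cong (λ k → window hω k 22) s≡6q+r) (window-from-parent q r<6)

take2-window : ∀ s → take 2 (window hω s 22) ≡ window hω s 2
take2-window s = take-window hω s (m≤m+n 2 20)

ReversalFree : List (Word 5) → Set
ReversalFree S = All (λ v → All (λ w → take 2 w ≢ reverse (take 2 v)) S) S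

reversalFree? : ∀ S → Dec (ReversalFree S)
reversalFree? S = all? (λ v → all? (λ w → ¬? (≡-dec _≟_ (take 2 w) (reverse (take 2 v)))) S) S

factors22-reversalFree : ReversalFree factors22
factors22-reversalFree = from-does (reversalFree? factors22) refl

hω-tournament : InfTournament hω
hω-tournament i j _ (k , ij≡) (l , ji≡) =
  All.lookup (All.lookup factors22-reversalFree (window∈factors22 k)) (window∈factors22 l) reversed
  where
  reversed : take 2 (window hω l 22) ≡ reverse (take 2 (window hω k 22))
  reversed = trans (take2-window l) (trans (sym ji≡) (cong reverse (trans ij≡ (sym (take2-window k)))))

factors22-shortSquareFree : All (λ v → ∀ {k} → k < 11 → take (suc k) v ≢ take (suc k) (drop (suc k) v)) factors22
factors22-shortSquareFree =
  from-does (all? (λ v → allUpTo? (λ k → ¬? (≡-dec _≟_ (take (suc k) v) (take (suc k) (drop (suc k) v)))) 11) factors22) refl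

no-short-square : ∀ s {k} → k < 11 → ¬ Square hω s (suc k)
no-short-square s {k} k<11 sq = All.lookup factors22-shortSquareFree (window∈factors22 s) k<11 (begin
  take p (window hω s 22)            ≡⟨ take-window hω s (≤-trans k<11 (m≤m+n 11 11)) ⟩
  window hω s p                      ≡⟨ sq ⟩
  window hω (s + p) p                ≡⟨ take-drop-window hω s (+-mono-≤ k<11 k<11) ⟨
  take p (drop p (window hω s 22))   ∎)
  where
  open ≡-Reasoning
  p = suc k

h-injective : ∀ a b → h a ≡ h b → a ≡ b
h-injective = from-does (Fin.all? λ a → Fin.all? λ b → ≡-dec _≟_ (h a) (h b) →-dec (a ≟ b)) refl

h-synchronizing : All (λ v → ∀ {e} → e < 5 → ∀ a → take 6 (drop (suc e) (concatMap h (take 2 v))) ≢ h a) factors22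
h-synchronizing = from-does (all? (λ v → allUpTo? (λ e → Fin.all? λ a →
  ¬? (≡-dec _≟_ (take 6 (drop (suc e) (concatMap h (take 2 v)))) (h a))) 5) factors22) refl

h-split : ∀ a b c {r} → r < 6 → drop r (h a) ≡ drop r (h b) → take r (h b) ≡ take r (h c) → a ≡ b ⊎ b ≡ c
h-split = from-does (Fin.all? λ a → Fin.all? λ b → Fin.all? λ c → allUpTo? (λ r →
  ≡-dec _≟_ (drop r (h a)) (drop r (h b)) →-dec ≡-dec _≟_ (take r (h b)) (take r (h c)) →-dec (a ≟ b ⊎-dec b ≟ c)) 6) refl

-- Squares of large period

no-unaligned-square : ∀ s {m e} → 2 ≤ m → e < 5 → ¬ Square hω s (6 * m + suc e)
no-unaligned-square s {m} {e} 2≤m e<5 sq =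
  All.lookup h-synchronizing (window∈factors22 b) e<5 (hω (suc q)) (sym block≡)
  where
  open Position s
  open ≡-Reasoning
  p = 6 * m + suc e
  b = suc q + m
  g+6≤p : g + 6 ≤ p
  g+6≤p = ≤-trans (+-monoˡ-≤ 6 g≤6) (≤-trans (*-monoʳ-≤ 6 2≤m) (m≤m+n (6 * m) (suc e)))
  s+g+p≡ : s + g + p ≡ 6 * b + suc e
  s+g+p≡ = trans (cong (_+ p) s+g≡6[1+q]) (regroup (suc q) m (suc e))
    where
    regroup : ∀ a m e → 6 * a + (6 * m + e) ≡ 6 * (a + m) + e
    regroup = solve-∀
  block≡ : h (hω (suc q)) ≡ take 6 (drop (suc e) (concatMap h (take 2 (window hω b 22))))
  block≡ = begin
    h (hω (suc q))                                        ≡⟨ hω-block (suc q) ⟨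
    window hω (6 * suc q) 6                               ≡⟨ cong (λ k → window hω k 6) s+g≡6[1+q] ⟨
    window hω (s + g) 6                                   ≡⟨ Square-window hω sq g+6≤p ⟩
    window hω (s + g + p) 6                               ≡⟨ cong (λ k → window hω k 6) s+g+p≡ ⟩
    window hω (6 * b + suc e) 6                           ≡⟨ take-drop-window hω (6 * b) {N = 12} (≤-trans (+-monoˡ-≤ 6 e<5) (n≤1+n 11)) ⟨
    take 6 (drop (suc e) (window hω (6 * b) 12))          ≡⟨ cong (take 6 ∘ drop (suc e)) (hω-blocks b 2) ⟩
    take 6 (drop (suc e) (concatMap h (window hω b 2)))   ≡⟨ cong (take 6 ∘ drop (suc e) ∘ concatMap h) (take2-window b) ⟨
    take 6 (drop (suc e) (concatMap h (take 2 (window hω b 22)))) ∎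

-- Writing A, B, C for the letters of hω at q, q + m and q + 2 m: the square covers
-- the tail of h A, the blocks in between and the head of h B, and its copy
-- covers the tail of h B, … and the head of h C.
square-descent : ∀ s {m} → 2 ≤ m → Square hω s (6 * m) → Square hω (s / 6) m ⊎ Square hω (suc (s / 6)) m
square-descent s {m@(suc m′)} 2≤m sq = Sum.map A≡B⇒square B≡C⇒square (h-split A B C r<6 tails heads)
  where
  open Position s
  open ≡-Reasoning
  A B C : Fin 5
  A = hω q
  B = hω (q + m)
  C = hω (q + m + m)

  block-copy : ∀ k t {L} → s + t ≡ 6 * k → t + L ≤ 6 * m → window hω (6 * k) L ≡ window hω (6 * (k + m)) L
  block-copy k t {L} s+t≡6k t+L≤6m = begin
    window hω (6 * k) L             ≡⟨ cong (λ i → window hω i L) s+t≡6k ⟨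
    window hω (s + t) L             ≡⟨ Square-window hω sq t+L≤6m ⟩
    window hω (s + t + 6 * m) L     ≡⟨ cong (λ i → window hω (i + 6 * m) L) s+t≡6k ⟩
    window hω (6 * k + 6 * m) L     ≡⟨ cong (λ i → window hω i L) (*-distribˡ-+ 6 k m) ⟨
    window hω (6 * (k + m)) L       ∎

  s+[g+6i]≡6[q+1+i] : ∀ i → s + (g + 6 * i) ≡ 6 * (q + suc i)
  s+[g+6i]≡6[q+1+i] i = begin
    s + (g + 6 * i)    ≡⟨ +-assoc s g (6 * i) ⟨
    s + g + 6 * i      ≡⟨ cong (_+ 6 * i) s+g≡6[1+q] ⟩
    6 * suc q + 6 * i  ≡⟨ *-distribˡ-+ 6 (suc q) i ⟨
    6 * (suc q + i)    ≡⟨ cong (6 *_) (+-suc q i) ⟨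
    6 * (q + suc i)    ∎

  tails : drop r (h A) ≡ drop r (h B)
  tails = begin
    drop r (h A)                     ≡⟨ drop-block q r+g≡6 ⟩
    window hω (6 * q + r) g          ≡⟨ cong (λ i → window hω i g) (trans (sym s≡6q+r) (sym (+-identityʳ s))) ⟩
    window hω (s + 0) g              ≡⟨ Square-window hω sq (≤-trans g≤6 (*-monoʳ-≤ 6 (≤-trans (n≤1+n 1) 2≤m))) ⟩
    window hω (s + 0 + 6 * m) g      ≡⟨ cong (λ i → window hω (i + 6 * m) g) (trans (+-identityʳ s) s≡6q+r) ⟩
    window hω (6 * q + r + 6 * m) g  ≡⟨ cong (λ i → window hω i g) (regroup q r m) ⟩
    window hω (6 * (q + m) + r) g    ≡⟨ drop-block (q + m) r+g≡6 ⟨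
    drop r (h B)                     ∎
    where
    regroup : ∀ q r m → 6 * q + r + 6 * m ≡ 6 * (q + m) + r
    regroup = solve-∀

  heads : take r (h B) ≡ take r (h C)
  heads = begin
    take r (h B)                    ≡⟨ take-block (q + m) (<⇒≤ r<6) ⟩
    window hω (6 * (q + m)) r       ≡⟨ block-copy (q + m) (g + 6 * m′) (s+[g+6i]≡6[q+1+i] m′) (≤-reflexive fits) ⟩
    window hω (6 * (q + m + m)) r   ≡⟨ take-block (q + m + m) (<⇒≤ r<6) ⟨
    take r (h C)                    ∎
    where
    fits : g + 6 * m′ + r ≡ 6 * m
    fits = begin
      g + 6 * m′ + r    ≡⟨ +-comm (g + 6 * m′) r ⟩
      r + (g + 6 * m′)  ≡⟨ +-assoc r g (6 * m′) ⟨
      r + g + 6 * m′    ≡⟨ cong (_+ 6 * m′) r+g≡6 ⟩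
      6 + 6 * m′        ≡⟨ *-suc 6 m′ ⟨
      6 * m             ∎

  middle : ∀ i → suc i < m → hω (q + suc i) ≡ hω (q + suc i + m)
  middle i 2+i≤m = h-injective _ _ (begin
    h (hω k)                      ≡⟨ hω-block k ⟨
    window hω (6 * k) 6           ≡⟨ block-copy k (g + 6 * i) (s+[g+6i]≡6[q+1+i] i) fits ⟩
    window hω (6 * (k + m)) 6     ≡⟨ hω-block (k + m) ⟩
    h (hω (k + m))                ∎)
    where
    k = q + suc i
    fits : g + 6 * i + 6 ≤ 6 * m
    fits = ≤-trans (+-monoˡ-≤ 6 (+-monoˡ-≤ (6 * i) g≤6)) (≤-trans (≤-reflexive (regroup i)) (*-monoʳ-≤ 6 2+i≤m))
      where
      regroup : ∀ i → 6 + 6 * i + 6 ≡ 6 * suc (suc i)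
      regroup = solve-∀

  A≡B⇒square : A ≡ B → Square hω q m
  A≡B⇒square A≡B = window-cong q (q + m) m same
    where
    same : ∀ t → t < m → hω (q + t) ≡ hω (q + m + t)
    same zero    _     = trans (cong hω (+-identityʳ q)) (trans A≡B (cong hω (sym (+-identityʳ (q + m)))))
    same (suc i) 1+i<m = trans (middle i 1+i<m) (cong hω (swap q (suc i) m))
      where
      swap : ∀ a b c → a + b + c ≡ a + c + b
      swap = solve-∀

  B≡C⇒square : B ≡ C → Square hω (suc q) m
  B≡C⇒square B≡C = window-cong (suc q) (suc q + m) m same
    where
    same : ∀ t → t < m → hω (suc q + t) ≡ hω (suc q + m + t)
    same t t<m with m≤n⇒m<n∨m≡n t<m
    ... | inj₁ 1+t<m = trans (cong hω (sym (+-suc q t))) (trans (middle t 1+t<m) (cong hω (swap q t m)))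
      where
      swap : ∀ a b c → a + suc b + c ≡ suc a + c + b
      swap = solve-∀
    ... | inj₂ refl  = trans (cong hω (sym (+-suc q t))) (trans B≡C (cong hω (swap q t)))
      where
      swap : ∀ a b → a + suc b + suc b ≡ suc a + suc b + b
      swap = solve-∀

no-long-square : ∀ s {m e} → 2 ≤ m → e < 6 → (∀ s′ → ¬ Square hω s′ m) → ¬ Square hω s (6 * m + e)
no-long-square s {m} {zero}  2≤m _   no-m-square sq =
  [ no-m-square (s / 6) , no-m-square (suc (s / 6)) ]′ (square-descent s 2≤m (subst (Square hω s) (+-identityʳ (6 * m)) sq))
no-long-square s {m} {suc e} 2≤m e<6 _ = no-unaligned-square s 2≤m (≤-pred e<6)

no-square : ∀ p s → 1 ≤ p → ¬ Square hω s p
no-square = <-rec _ step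
  where
  step : ∀ p → (∀ {p′} → p′ < p → ∀ s → 1 ≤ p′ → ¬ Square hω s p′) → ∀ s → 1 ≤ p → ¬ Square hω s p
  step (suc k) ih s _ with k <? 11
  ... | yes k<11 = no-short-square s k<11
  ... | no  k≮11 = no-long-square s 2≤m r<6 (λ s′ → ih m<p s′ (≤-trans (n≤1+n 1) 2≤m)) ∘ subst (Square hω s) s≡6q+r
    where
    open Position (suc k) renaming (q to m)
    2≤m : 2 ≤ m
    2≤m = /-monoˡ-≤ 6 (s≤s (≮⇒≥ k≮11))
    m<p : m < suc k
    m<p = m/n<m (suc k) 6 (s≤s (s≤s z≤n))

hω-squareFree : InfSquareFree hω
hω-squareFree []      []≢[] _ = []≢[] refl
hω-squareFree (a ∷ u) _     f with s , sq ← InfFactor-square hω (a ∷ u) f = no-square (suc (length u)) s (s≤s z≤n) sq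

theorem12 : ((SFT w₀ × length w₀ ≡ 20)
    × ((w : Word 4) → SFT w → length w ≤ 20)
    × ((w : Word 4) → SFT w → length w ≡ 20 →
         ∃[ π ] (w ≡ map (π ⟨$⟩ʳ_) w₀))
    × ((π : Permutation′ 4) → SFT (map (π ⟨$⟩ʳ_) w₀)))
  × (∃[ w ] (InfSquareFree {5} w × InfTournament w))
theorem12 =
    ( (SFT-w₀ , refl)
    , SFT-length≤20
    , SFT-length20-renaming
    , (λ π → SFT-map (rename-injective π) SFT-w₀) )
  , (hω , hω-squareFree , hω-tournament)
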